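{- For the $n$-variable monomial $x_{[k]}=x_1x_2\cdots x_k$ we have $N_k(x_{[k]})=\{U\in\mathcal{U}_{n,k}:\ G_U[[k]]=I_k\}$ and $|N_k(x_{[k]})|=2^{k(n-k)}$, where $I_k$ is the $k\times k$ identity matrix.
   Context: $\mathcal{U}_{n,k}$ is the set of $k$-dimensional linear subspaces of $\mathbb{F}_2^n$. For $U\in\mathcal{U}_{n,k}$, $G_U$ is the unique $k\times n$ rank-$k$ matrix over $\mathbb{F}_2$ in reduced row echelon form whose rows span $U$; $G_U[[k]]$ is the submatrix formed by its first $k$ columns. $N_k(g)$ is the set of $U\in\mathcal{U}_{n,k}$ with $\sum_{x\in U}g(x)\neq 0$. -}

module Defs where

open import Data.Bool using (Bool; true; false; _xor_; _∧_; if_then_else_)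
open import Data.Nat using (ℕ; zero; suc; _≤_)
open import Data.Fin using (Fin; _<_; inject≤)
open import Data.Fin.Properties using (_≟_)
open import Data.Vec using (Vec; []; _∷_; lookup; replicate; zipWith)
open import Data.List using (List; []; _∷_; _++_; map; filter; foldr; length)
open import Data.List.Relation.Unary.All using (All)
open import Data.List.Relation.Unary.Any using (Any)
open import Data.List.Relation.Unary.AllPairs using (AllPairs)
open import Data.Product using (Σ; _×_; _,_)
open import Function.Bundles using (_⇔_)
open import Relation.Binary.PropositionalEquality using (_≡_)
open import Relation.Nullary using (¬_; does)
open import Relation.Nullary.Decidable using (⌊_⌋)

-- F₂ is Bool with xor as addition and ∧ as multiplication.
-- Vectors of F₂ⁿ.
F2^ : ℕ → Set
F2^ n = Vec Bool n

-- Matrices over F₂ with k rows and n columns (list of rows).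
Mat : ℕ → ℕ → Set
Mat k n = Vec (F2^ n) k

zeroV : ∀ {n} → F2^ n
zeroV = replicate _ false

_⊕_ : ∀ {n} → F2^ n → F2^ n → F2^ n
_⊕_ = zipWith _xor_

scale : ∀ {n} → Bool → F2^ n → F2^ n
scale b v = Data.Vec.map (b ∧_) v

comb : ∀ {k n} → F2^ k → Mat k n → F2^ n
comb [] [] = zeroV
comb (c ∷ cs) (r ∷ rs) = scale c r ⊕ comb cs rs

InSpan : ∀ {k n} → Mat k n → F2^ n → Set
InSpan {k} G x = Σ (F2^ k) λ c → comb c G ≡ x

LinIndep : ∀ {k n} → Mat k n → Set
LinIndep {k} G = (c : F2^ k) → comb c G ≡ zeroV → c ≡ zeroV

-- Subsets of F₂ⁿ, as (decidable) characteristic functions.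
Sub : ℕ → Set
Sub n = F2^ n → Bool

_≐_ : ∀ {n} → Sub n → Sub n → Set
U ≐ V = ∀ x → U x ≡ V x

SpannedBy : ∀ {k n} → Sub n → Mat k n → Set
SpannedBy U G = ∀ x → (U x ≡ true) ⇔ InSpan G x

-- U ∈ 𝒰_{n,k}: U is a k-dimensional linear subspace of F₂ⁿ,
-- i.e. U has a basis of k vectors.
InU : (n k : ℕ) → Sub n → Set
InU n k U = Σ (Mat k n) λ B → LinIndep B × SpannedBy U B

allVecs : (n : ℕ) → List (F2^ n)
allVecs zero = [] ∷ []
allVecs (suc n) = map (false ∷_) (allVecs n) ++ map (true ∷_) (allVecs n)

sumOver : ∀ {n} → Sub n → (F2^ n → Bool) → Bool
sumOver {n} U g = foldr _xor_ false (map g (filter (λ x → U x Data.Bool.≟ true) (allVecs n)))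

-- N_k(g) = { U ∈ 𝒰_{n,k} : Σ_{x∈U} g(x) ≠ 0 }
InN : (n k : ℕ) → (F2^ n → Bool) → Sub n → Set
InN n k g U = InU n k U × (sumOver U g ≡ true)

-- the n-variable monomial x_[k] = x₁ x₂ ⋯ x_k (meaningful for k ≤ n)
mono : (k : ℕ) → ∀ {n} → F2^ n → Bool
mono zero x = true
mono (suc k) [] = true
mono (suc k) (b ∷ x) = b ∧ mono k x

IsRREF : ∀ {k n} → Mat k n → Set
IsRREF {k} {n} G = Σ (Fin k → Fin n) λ p →
    (∀ i j → i < j → p i < p j)
  × (∀ i → lookup (lookup G i) (p i) ≡ true)
  × (∀ i (j : Fin n) → j < p i → lookup (lookup G i) j ≡ false)
  × (∀ i i' → ¬ i ≡ i' → lookup (lookup G i') (p i) ≡ false)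

IsGU : ∀ {k n} → Sub n → Mat k n → Set
IsGU U G = IsRREF G × LinIndep G × SpannedBy U G

FirstColsId : ∀ {k n} → k ≤ n → Mat k n → Set
FirstColsId {k} k≤n G = ∀ (i j : Fin k) →
  lookup (lookup G i) (inject≤ j k≤n) ≡ ⌊ i ≟ j ⌋

-- the set of subsets satisfying P (P respecting ≐) has exactly m elements
-- up to extensional equality
CardIs : ∀ {n} → (Sub n → Set) → ℕ → Set
CardIs {n} P m = Σ (List (Sub n)) λ L →
    length L ≡ m
  × All P L
  × AllPairs (λ U V → ¬ (U ≐ V)) L
  × (∀ U → P U → Any (U ≐_) L)

module Submission where

-- Split F₂^(k+m) as F₂^k × F₂^m. As x_[k] vanishes off {1ᵏ} × F₂^m, the sum of x_[k] over U is the
-- parity of the number of v with 1ᵏ ++ v ∈ U. If U contains some 0ᵏ ++ w with w ≠ 0, translating by it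
-- pairs these v off and the sum is 0. Otherwise U projects injectively, hence (dim U = k) bijectively,
-- onto F₂^k, so U is the graph {u ++ uA} of a k×m matrix A, exactly one v qualifies and the sum is 1.
-- Thus N_k(x_[k]) is the set of such graphs, one for each of the 2^(k(n-k)) matrices A. For the reduced
-- echelon basis G_U: either every pivot lies in the first k columns, forcing G_U = [ I ∣ A ], or a row
-- with a later pivot is a vector 0ᵏ ++ w with w ≠ 0.

open import Defs
open import Data.Nat using (ℕ; _≤_; _*_; _∸_; _^_)
open import Data.Product using (_×_)
open import Function.Bundles using (_⇔_)

open import Data.Bool as Bool using (Bool; true; false; _xor_; _∧_)
open import Data.Bool.Properties
  using ( xor-assoc; xor-comm; xor-identityˡ; xor-identityʳ; xor-same
        ; ∧-zeroʳ; ∧-identityʳ; ∧-distribʳ-xor; ⇔→≡)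
open import Data.Nat as ℕ using (zero; suc; _+_)
import Data.Nat.Properties as ℕ
open import Data.Fin as Fin using (Fin; zero; suc; toℕ)
open import Data.Fin.Properties as Fin using (pigeonhole; punchOut-injective)
open import Data.List as List using (List; foldr; filter)
open import Data.Product using (Σ; _,_; proj₁; proj₂)
open import Data.Sum using (_⊎_; inj₁; inj₂)
open import Data.Vec as Vec using (Vec; []; _∷_; _++_; lookup; map; replicate; zipWith; take; drop)
open import Data.Vec.Properties
  using ( zipWith-assoc; zipWith-comm; zipWith-identityˡ; zipWith-identityʳ; zipWith-++
        ; map-id; map-const; map-++; map-replicate; lookup-map; lookup-replicate
        ; take++drop≡id; tabulate∘lookup; tabulate-cong; ++-injectiveˡ)
import Data.Vec.Properties as Vec
import Data.List.Properties as List
import Data.List.Relation.Unary.All.Properties as All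
import Data.List.Relation.Unary.AllPairs.Properties as AllPairs
import Data.List.Relation.Unary.Any.Properties as Any
open import Function using (_∘_; id)
open import Function.Bundles using (mk⇔; Equivalence; _↔_; Inverse; mk↔ₛ′)
open import Function.Properties.Inverse using (↔-sym; ↔-trans)
open import Data.Product.Function.NonDependent.Propositional using (_×-↔_)
open import Function.Definitions using (Injective; StrictlySurjective)
open import Relation.Binary.PropositionalEquality
open import Relation.Nullary using (Dec; yes; no; does; contradiction)
open import Relation.Nullary.Decidable using (⌊_⌋; ⌊⌋-map′; dec-true)

private
  variable
    j k m n : ℕ
    X : Set

lookup-ext : {xs ys : Vec X n} → (∀ i → lookup xs i ≡ lookup ys i) → xs ≡ ys
lookup-ext {xs = xs} {ys} eq =
  trans (sym (tabulate∘lookup xs)) (trans (tabulate-cong eq) (tabulate∘lookup ys))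

take-++ : (u : Vec X k) (v : Vec X m) → take k (u ++ v) ≡ u
take-++ []      v = refl
take-++ (a ∷ u) v = cong (a ∷_) (take-++ u v)

drop-++ : (u : Vec X k) (v : Vec X m) → drop k (u ++ v) ≡ v
drop-++ []      v = refl
drop-++ (a ∷ u) v = drop-++ u v

does≡true⇒ : {P : Set} (p? : Dec P) → does p? ≡ true → P
does≡true⇒ (yes p) _ = p
does≡true⇒ (no _) ()

⊕-assoc : (x y z : F2^ n) → (x ⊕ y) ⊕ z ≡ x ⊕ (y ⊕ z)
⊕-assoc = zipWith-assoc xor-assoc

⊕-comm : (x y : F2^ n) → x ⊕ y ≡ y ⊕ x
⊕-comm = zipWith-comm xor-comm

⊕-identityˡ : (x : F2^ n) → zeroV ⊕ x ≡ x
⊕-identityˡ = zipWith-identityˡ xor-identityˡ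

⊕-identityʳ : (x : F2^ n) → x ⊕ zeroV ≡ x
⊕-identityʳ = zipWith-identityʳ xor-identityʳ

⊕-self : (x : F2^ n) → x ⊕ x ≡ zeroV
⊕-self []      = refl
⊕-self (b ∷ x) = cong₂ _∷_ (xor-same b) (⊕-self x)

⊕-involutive : (x y : F2^ n) → (x ⊕ y) ⊕ y ≡ x
⊕-involutive x y = begin
  (x ⊕ y) ⊕ y  ≡⟨ ⊕-assoc x y y ⟩
  x ⊕ (y ⊕ y)  ≡⟨ cong (x ⊕_) (⊕-self y) ⟩
  x ⊕ zeroV    ≡⟨ ⊕-identityʳ x ⟩
  x            ∎
  where open ≡-Reasoning

⊕-cancel : (x y : F2^ n) → x ⊕ y ≡ zeroV → x ≡ y
⊕-cancel x y x⊕y≡0 = begin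
  x            ≡⟨ sym (⊕-involutive x y) ⟩
  (x ⊕ y) ⊕ y  ≡⟨ cong (_⊕ y) x⊕y≡0 ⟩
  zeroV ⊕ y    ≡⟨ ⊕-identityˡ y ⟩
  y            ∎
  where open ≡-Reasoning

⊕-interchange : (a b c d : F2^ n) → (a ⊕ b) ⊕ (c ⊕ d) ≡ (a ⊕ c) ⊕ (b ⊕ d)
⊕-interchange a b c d = begin
  (a ⊕ b) ⊕ (c ⊕ d)  ≡⟨ ⊕-assoc a b (c ⊕ d) ⟩
  a ⊕ (b ⊕ (c ⊕ d))  ≡⟨ cong (a ⊕_) (sym (⊕-assoc b c d)) ⟩
  a ⊕ ((b ⊕ c) ⊕ d)  ≡⟨ cong (λ z → a ⊕ (z ⊕ d)) (⊕-comm b c) ⟩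
  a ⊕ ((c ⊕ b) ⊕ d)  ≡⟨ cong (a ⊕_) (⊕-assoc c b d) ⟩
  a ⊕ (c ⊕ (b ⊕ d))  ≡⟨ sym (⊕-assoc a c (b ⊕ d)) ⟩
  (a ⊕ c) ⊕ (b ⊕ d)  ∎
  where open ≡-Reasoning

zeroV-++ : zeroV {k + m} ≡ zeroV {k} ++ zeroV {m}
zeroV-++ {zero}  = refl
zeroV-++ {suc k} = cong (false ∷_) (zeroV-++ {k})

scale-true : (x : F2^ n) → scale true x ≡ x
scale-true = map-id

scale-false : (x : F2^ n) → scale false x ≡ zeroV
scale-false x = map-const x false

scale-zeroV : (b : Bool) → scale b (zeroV {n}) ≡ zeroV
scale-zeroV {n} b = trans (map-replicate (b ∧_) false n) (cong (replicate n) (∧-zeroʳ b))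

scale-xor : (a b : Bool) (x : F2^ n) → scale (a xor b) x ≡ scale a x ⊕ scale b x
scale-xor a b []      = refl
scale-xor a b (x ∷ v) = cong₂ _∷_ (∧-distribʳ-xor x a b) (scale-xor a b v)

comb-zeroˡ : (M : Mat k n) → comb zeroV M ≡ zeroV
comb-zeroˡ []      = refl
comb-zeroˡ (r ∷ M) = trans (cong₂ _⊕_ (scale-false r) (comb-zeroˡ M)) (⊕-identityˡ zeroV)

comb-⊕ : (c d : F2^ k) (M : Mat k n) → comb (c ⊕ d) M ≡ comb c M ⊕ comb d M
comb-⊕ []      []      []      = sym (⊕-identityˡ zeroV)
comb-⊕ (a ∷ c) (b ∷ d) (r ∷ M) = begin
  scale (a xor b) r ⊕ comb (c ⊕ d) M                 ≡⟨ cong₂ _⊕_ (scale-xor a b r) (comb-⊕ c d M) ⟩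
  (scale a r ⊕ scale b r) ⊕ (comb c M ⊕ comb d M)   ≡⟨ ⊕-interchange _ _ _ _ ⟩
  (scale a r ⊕ comb c M) ⊕ (scale b r ⊕ comb d M)   ∎
  where open ≡-Reasoning

comb-scale : (b : Bool) (c : F2^ k) (M : Mat k n) → comb (scale b c) M ≡ scale b (comb c M)
comb-scale true  c M = trans (cong (λ c → comb c M) (scale-true c)) (sym (scale-true _))
comb-scale false c M =
  trans (cong (λ c → comb c M) (scale-false c)) (trans (comb-zeroˡ M) (sym (scale-false _)))

_·_ : Mat j k → Mat k n → Mat j n
C · M = map (λ c → comb c M) C

comb-· : (u : F2^ j) (C : Mat j k) (M : Mat k n) → comb u (C · M) ≡ comb (comb u C) M
comb-· []      []      M = sym (comb-zeroˡ M)
comb-· (b ∷ u) (c ∷ C) M = begin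
  scale b (comb c M) ⊕ comb u (C · M)      ≡⟨ cong₂ _⊕_ (sym (comb-scale b c M)) (comb-· u C M) ⟩
  comb (scale b c) M ⊕ comb (comb u C) M  ≡⟨ sym (comb-⊕ (scale b c) (comb u C) M) ⟩
  comb (scale b c ⊕ comb u C) M           ∎
  where open ≡-Reasoning

[_∣_] : Mat j k → Mat j m → Mat j (k + m)
[ L ∣ R ] = zipWith _++_ L R

comb-[∣] : (c : F2^ j) (L : Mat j k) (R : Mat j m) → comb c [ L ∣ R ] ≡ comb c L ++ comb c R
comb-[∣] {k = k} {m} [] [] [] = zeroV-++ {k} {m}
comb-[∣] (b ∷ c) (l ∷ L) (r ∷ R) = begin
  scale b (l ++ r) ⊕ comb c [ L ∣ R ]
    ≡⟨ cong₂ _⊕_ (map-++ (b ∧_) l r) (comb-[∣] c L R) ⟩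
  (scale b l ++ scale b r) ⊕ (comb c L ++ comb c R)
    ≡⟨ zipWith-++ _xor_ (scale b l) (scale b r) (comb c L) (comb c R) ⟩
  (scale b l ⊕ comb c L) ++ (scale b r ⊕ comb c R)
    ∎
  where open ≡-Reasoning

[take∣drop] : (B : Mat j (k + m)) → [ map (take k) B ∣ map (drop k) B ] ≡ B
[take∣drop]     []      = refl
[take∣drop] {k = k} (r ∷ B) = cong₂ _∷_ (take++drop≡id k r) ([take∣drop] B)

I : Mat k k
I {zero}  = []
I {suc k} = (true ∷ zeroV) ∷ map (false ∷_) I

lookup-I : (i j : Fin k) → lookup (lookup I i) j ≡ ⌊ i Fin.≟ j ⌋
lookup-I zero    zero    = refl
lookup-I zero    (suc j) = lookup-replicate j false
lookup-I (suc i) zero    = cong (λ r → lookup r zero) (lookup-map i (false ∷_) I)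
lookup-I (suc i) (suc j) = begin
  lookup (lookup (map (false ∷_) I) i) (suc j)  ≡⟨ cong (λ r → lookup r (suc j)) (lookup-map i (false ∷_) I) ⟩
  lookup (lookup I i) j                         ≡⟨ lookup-I i j ⟩
  ⌊ i Fin.≟ j ⌋                                 ≡⟨ sym (⌊⌋-map′ _ _ (i Fin.≟ j)) ⟩
  ⌊ suc i Fin.≟ suc j ⌋                         ∎
  where open ≡-Reasoning

comb-false∷ : (c : F2^ j) (M : Mat j n) → comb c (map (false ∷_) M) ≡ false ∷ comb c M
comb-false∷ []      []      = refl
comb-false∷ (b ∷ c) (r ∷ M) = begin
  scale b (false ∷ r) ⊕ comb c (map (false ∷_) M)
    ≡⟨ cong (scale b (false ∷ r) ⊕_) (comb-false∷ c M) ⟩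
  ((b ∧ false) xor false) ∷ (scale b r ⊕ comb c M)
    ≡⟨ cong (λ x → (x xor false) ∷ (scale b r ⊕ comb c M)) (∧-zeroʳ b) ⟩
  false ∷ (scale b r ⊕ comb c M)
    ∎
  where open ≡-Reasoning

comb-I : (c : F2^ k) → comb c I ≡ c
comb-I []      = refl
comb-I (b ∷ c) = begin
  scale b (true ∷ zeroV) ⊕ comb c (map (false ∷_) I)  ≡⟨ cong (scale b (true ∷ zeroV) ⊕_) (comb-false∷ c I) ⟩
  ((b ∧ true) xor false) ∷ (scale b zeroV ⊕ comb c I)  ≡⟨ cong₂ _∷_ (trans (xor-identityʳ _) (∧-identityʳ b))
                                                                  (cong₂ _⊕_ (scale-zeroV b) (comb-I c)) ⟩
  b ∷ (zeroV ⊕ c)                                       ≡⟨ cong (b ∷_) (⊕-identityˡ c) ⟩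
  b ∷ c                                                 ∎
  where open ≡-Reasoning

comb-lookup-I : (i : Fin k) (M : Mat k n) → comb (lookup I i) M ≡ lookup M i
comb-lookup-I zero    (r ∷ M) = trans (cong₂ _⊕_ (scale-true r) (comb-zeroˡ M)) (⊕-identityʳ r)
comb-lookup-I (suc i) (r ∷ M) = begin
  comb (lookup (map (false ∷_) I) i) (r ∷ M)  ≡⟨ cong (λ c → comb c (r ∷ M)) (lookup-map i (false ∷_) I) ⟩
  scale false r ⊕ comb (lookup I i) M         ≡⟨ cong₂ _⊕_ (scale-false r) (comb-lookup-I i M) ⟩
  zeroV ⊕ lookup M i                          ≡⟨ ⊕-identityˡ _ ⟩
  lookup M i                                  ∎
  where open ≡-Reasoning

comb-[I∣] : (c : F2^ k) (A : Mat k m) → comb c [ I ∣ A ] ≡ c ++ comb c A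
comb-[I∣] c A = trans (comb-[∣] c I A) (cong (_++ comb c A) (comb-I c))

∑ : (F2^ n → Bool) → Bool
∑ {zero}  f = f []
∑ {suc n} f = ∑ (f ∘ (false ∷_)) xor ∑ (f ∘ (true ∷_))

∑-cong : {f g : F2^ n → Bool} → (∀ x → f x ≡ g x) → ∑ f ≡ ∑ g
∑-cong {zero}  f≗g = f≗g []
∑-cong {suc n} f≗g = cong₂ _xor_ (∑-cong (f≗g ∘ (false ∷_))) (∑-cong (f≗g ∘ (true ∷_)))

∑-false : (n : ℕ) → ∑ {n} (λ _ → false) ≡ false
∑-false zero    = refl
∑-false (suc n) = cong₂ _xor_ (∑-false n) (∑-false n)

_≟ᵥ_ : (v w : F2^ n) → Dec (v ≡ w)
_≟ᵥ_ = Vec.≡-dec Bool._≟_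

∑-indicator : (w : F2^ n) → ∑ (λ v → does (v ≟ᵥ w)) ≡ true
∑-indicator             []          = refl
∑-indicator {suc n} (false ∷ w) = cong₂ _xor_ (∑-indicator w) (∑-false n)
∑-indicator {suc n} (true ∷ w)  = cong₂ _xor_ (∑-false n) (∑-indicator w)

∑-translate : (w : F2^ n) (f : F2^ n → Bool) → ∑ (λ v → f (v ⊕ w)) ≡ ∑ f
∑-translate []          f = refl
∑-translate (false ∷ w) f =
  cong₂ _xor_ (∑-translate w (f ∘ (false ∷_))) (∑-translate w (f ∘ (true ∷_)))
∑-translate (true ∷ w)  f =
  trans (cong₂ _xor_ (∑-translate w (f ∘ (true ∷_))) (∑-translate w (f ∘ (false ∷_))))
        (xor-comm (∑ (f ∘ (true ∷_))) (∑ (f ∘ (false ∷_))))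

-- Along a coordinate where w is 1, translation by w swaps the two halves of the sum.
∑-vanishes : (w : F2^ n) → w ≢ zeroV → (f : F2^ n → Bool) → (∀ v → f (v ⊕ w) ≡ f v) → ∑ f ≡ false
∑-vanishes []          w≢0 f f-inv = contradiction refl w≢0
∑-vanishes (false ∷ w) w≢0 f f-inv = cong₂ _xor_
  (∑-vanishes w (w≢0 ∘ cong (false ∷_)) (f ∘ (false ∷_)) (f-inv ∘ (false ∷_)))
  (∑-vanishes w (w≢0 ∘ cong (false ∷_)) (f ∘ (true ∷_)) (f-inv ∘ (true ∷_)))
∑-vanishes (true ∷ w)  w≢0 f f-inv =
  trans (cong (∑ (f ∘ (false ∷_)) xor_) halves) (xor-same (∑ (f ∘ (false ∷_))))
  where
  halves : ∑ (f ∘ (true ∷_)) ≡ ∑ (f ∘ (false ∷_))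
  halves = trans (sym (∑-translate w (f ∘ (true ∷_)))) (∑-cong (f-inv ∘ (false ∷_)))

ones : (k : ℕ) → F2^ k
ones k = replicate k true

∑-mono : (k : ℕ) (h : F2^ (k + m) → Bool) → ∑ (λ x → h x ∧ mono k x) ≡ ∑ (λ v → h (ones k ++ v))
∑-mono zero    h = ∑-cong (∧-identityʳ ∘ h)
∑-mono {m} (suc k) h = cong₂ _xor_
  (trans (∑-cong (∧-zeroʳ ∘ h ∘ (false ∷_))) (∑-false (k + m)))
  (∑-mono k (h ∘ (true ∷_)))

xorSum : List Bool → Bool
xorSum = foldr _xor_ false

xorSum-++ : (xs ys : List Bool) → xorSum (xs List.++ ys) ≡ xorSum xs xor xorSum ys
xorSum-++ List.[]       ys = refl
xorSum-++ (x List.∷ xs) ys = trans (cong (x xor_) (xorSum-++ xs ys)) (sym (xor-assoc x _ _))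

xorSum-allVecs : (f : F2^ n → Bool) → xorSum (List.map f (allVecs n)) ≡ ∑ f
xorSum-allVecs {zero}  f = xor-identityʳ (f [])
xorSum-allVecs {suc n} f = begin
  xorSum (List.map f (List.map (false ∷_) vs List.++ List.map (true ∷_) vs))
    ≡⟨ cong xorSum (List.map-++ f (List.map (false ∷_) vs) _) ⟩
  xorSum (List.map f (List.map (false ∷_) vs) List.++ List.map f (List.map (true ∷_) vs))
    ≡⟨ xorSum-++ (List.map f (List.map (false ∷_) vs)) _ ⟩
  xorSum (List.map f (List.map (false ∷_) vs)) xor xorSum (List.map f (List.map (true ∷_) vs))
    ≡⟨ cong₂ (λ xs ys → xorSum xs xor xorSum ys) (sym (List.map-∘ vs)) (sym (List.map-∘ vs)) ⟩
  xorSum (List.map (f ∘ (false ∷_)) vs) xor xorSum (List.map (f ∘ (true ∷_)) vs)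
    ≡⟨ cong₂ _xor_ (xorSum-allVecs (f ∘ (false ∷_))) (xorSum-allVecs (f ∘ (true ∷_))) ⟩
  ∑ f ∎
  where
  open ≡-Reasoning
  vs : List (F2^ n)
  vs = allVecs n

xorSum-filter : (U : Sub n) (g : F2^ n → Bool) (xs : List (F2^ n)) →
  xorSum (List.map g (filter (λ x → U x Bool.≟ true) xs)) ≡ xorSum (List.map (λ x → U x ∧ g x) xs)
xorSum-filter U g List.[]       = refl
xorSum-filter U g (x List.∷ xs) with U x
... | true  = cong (g x xor_) (xorSum-filter U g xs)
... | false = xorSum-filter U g xs

sumOver-∑ : (U : Sub n) (g : F2^ n → Bool) → sumOver U g ≡ ∑ (λ x → U x ∧ g x)
sumOver-∑ {n} U g = trans (xorSum-filter U g (allVecs n)) (xorSum-allVecs {n} _)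

sumOver-cong : {U V : Sub n} (g : F2^ n → Bool) → U ≐ V → sumOver U g ≡ sumOver V g
sumOver-cong {U = U} {V} g U≐V =
  trans (sumOver-∑ U g) (trans (∑-cong (λ x → cong (_∧ g x) (U≐V x))) (sym (sumOver-∑ V g)))

sumOver-mono : (k : ℕ) (U : Sub (k + m)) → sumOver U (mono k) ≡ ∑ (λ v → U (ones k ++ v))
sumOver-mono k U = trans (sumOver-∑ U (mono k)) (∑-mono k U)

⊕-Closed : Sub n → Set
⊕-Closed U = ∀ {x y} → U x ≡ true → U y ≡ true → U (x ⊕ y) ≡ true

spannedBy-comb : {U : Sub n} {G : Mat k n} → SpannedBy U G → (c : F2^ k) → U (comb c G) ≡ true
spannedBy-comb span c = Equivalence.from (span _) (c , refl)

spannedBy⇒⊕-closed : {U : Sub n} {G : Mat k n} → SpannedBy U G → ⊕-Closed U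
spannedBy⇒⊕-closed {U = U} {G} span Ux Uy with Equivalence.to (span _) Ux | Equivalence.to (span _) Uy
... | c , refl | d , refl = subst (λ x → U x ≡ true) (comb-⊕ c d G) (spannedBy-comb span (c ⊕ d))

spannedBy-unique : {U V : Sub n} {G : Mat k n} → SpannedBy U G → SpannedBy V G → U ≐ V
spannedBy-unique U-span V-span x = ⇔→≡ (mk⇔
  (Equivalence.from (V-span x) ∘ Equivalence.to (U-span x))
  (Equivalence.from (U-span x) ∘ Equivalence.to (V-span x)))

⊕-shift : {U : Sub n} → ⊕-Closed U → {x y : F2^ n} → U y ≡ true → U (x ⊕ y) ≡ U x
⊕-shift {U = U} closed {x} {y} Uy = ⇔→≡ (mk⇔
  (λ Ux⊕y → subst (λ z → U z ≡ true) (⊕-involutive x y) (closed Ux⊕y Uy))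
  (λ Ux → closed Ux Uy))

sumOver-mono-vanishes : {U : Sub (k + m)} {w : F2^ m} → ⊕-Closed U →
  U (zeroV {k} ++ w) ≡ true → w ≢ zeroV → sumOver U (mono k) ≡ false
sumOver-mono-vanishes {k} {U = U} {w} closed U0w w≢0 =
  trans (sumOver-mono k U) (∑-vanishes w w≢0 (λ v → U (ones k ++ v)) λ v →
    trans (cong U (shift v)) (⊕-shift {U = U} closed U0w))
  where
  shift : (v : F2^ _) → ones k ++ (v ⊕ w) ≡ (ones k ++ v) ⊕ (zeroV ++ w)
  shift v = begin
    ones k ++ (v ⊕ w)              ≡⟨ cong (_++ (v ⊕ w)) (sym (⊕-identityʳ (ones k))) ⟩
    (ones k ⊕ zeroV) ++ (v ⊕ w)    ≡⟨ sym (zipWith-++ _xor_ (ones k) v zeroV w) ⟩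
    (ones k ++ v) ⊕ (zeroV ++ w)   ∎
    where open ≡-Reasoning

-- { u ++ u A : u ∈ F₂^k }, where comb u A is the row vector u times A.
graph : Mat k m → Sub (k + m)
graph {k} A x = does (drop k x ≟ᵥ comb (take k x) A)

graph-++ : (A : Mat k m) (u : F2^ k) (v : F2^ m) → graph A (u ++ v) ≡ does (v ≟ᵥ comb u A)
graph-++ A u v = cong₂ (λ d t → does (d ≟ᵥ comb t A)) (drop-++ u v) (take-++ u v)

graph-spannedBy : (A : Mat k m) → SpannedBy (graph A) [ I ∣ A ]
graph-spannedBy {k} A x = mk⇔ to from
  where
  to : graph A x ≡ true → InSpan [ I ∣ A ] x
  to x∈A = take k x , (begin
    comb (take k x) [ I ∣ A ]          ≡⟨ comb-[I∣] (take k x) A ⟩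
    take k x ++ comb (take k x) A      ≡⟨ cong (take k x ++_) (sym (does≡true⇒ (_ ≟ᵥ _) x∈A)) ⟩
    take k x ++ drop k x               ≡⟨ take++drop≡id k x ⟩
    x                                  ∎)
    where open ≡-Reasoning
  from : InSpan [ I ∣ A ] x → graph A x ≡ true
  from (c , refl) = begin
    graph A (comb c [ I ∣ A ])         ≡⟨ cong (graph A) (comb-[I∣] c A) ⟩
    graph A (c ++ comb c A)            ≡⟨ graph-++ A c (comb c A) ⟩
    does (comb c A ≟ᵥ comb c A)        ≡⟨ dec-true (comb c A ≟ᵥ comb c A) refl ⟩
    true                               ∎
    where open ≡-Reasoning

[I∣]-linIndep : (A : Mat k m) → LinIndep [ I ∣ A ]
[I∣]-linIndep {k} {m} A c c[I∣A]≡0 =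
  ++-injectiveˡ c zeroV (trans (sym (comb-[I∣] c A)) (trans c[I∣A]≡0 (zeroV-++ {k} {m})))

graph-injective : {A B : Mat k m} → graph A ≐ graph B → A ≡ B
graph-injective {A = A} {B} A≐B = lookup-ext λ i → begin
  lookup A i               ≡⟨ sym (comb-lookup-I i A) ⟩
  comb (lookup I i) A      ≡⟨ same-comb (lookup I i) ⟩
  comb (lookup I i) B      ≡⟨ comb-lookup-I i B ⟩
  lookup B i               ∎
  where
  open ≡-Reasoning
  same-comb : ∀ u → comb u A ≡ comb u B
  same-comb u = does≡true⇒ (_ ≟ᵥ _) (begin
    does (comb u A ≟ᵥ comb u B)  ≡⟨ sym (graph-++ B u (comb u A)) ⟩
    graph B (u ++ comb u A)      ≡⟨ sym (A≐B _) ⟩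
    graph A (u ++ comb u A)      ≡⟨ graph-++ A u (comb u A) ⟩
    does (comb u A ≟ᵥ comb u A)  ≡⟨ dec-true (comb u A ≟ᵥ comb u A) refl ⟩
    true                         ∎)

sumOver-mono-graph : (A : Mat k m) → sumOver (graph A) (mono k) ≡ true
sumOver-mono-graph {k} A = begin
  sumOver (graph A) (mono k)                 ≡⟨ sumOver-mono k (graph A) ⟩
  ∑ (λ v → graph A (ones k ++ v))            ≡⟨ ∑-cong (graph-++ A (ones k)) ⟩
  ∑ (λ v → does (v ≟ᵥ comb (ones k) A))      ≡⟨ ∑-indicator (comb (ones k) A) ⟩
  true                                       ∎
  where open ≡-Reasoning

graph-InN : (A : Mat k m) → InN (k + m) k (mono k) (graph A)
graph-InN A = ([ I ∣ A ] , [I∣]-linIndep A , graph-spannedBy A) , sumOver-mono-graph A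

-- If y were missed, punching it out of the codomain would inject Fin (suc n) into Fin n.
Fin-injective⇒surjective : (f : Fin n → Fin n) → Injective _≡_ _≡_ f → StrictlySurjective _≡_ f
Fin-injective⇒surjective {suc n} f f-inj y with Fin.any? (λ x → f x Fin.≟ y)
... | yes found = found
... | no missed =
  let i , j , i<j , collision = pigeonhole (ℕ.n<1+n n) (λ x → Fin.punchOut (y≢f x))
  in contradiction (f-inj (punchOut-injective (y≢f i) (y≢f j) collision)) (Fin.<⇒≢ i<j)
  where
  y≢f : ∀ x → y ≢ f x
  y≢f x y≡fx = missed (x , sym y≡fx)

↔Fin-injective⇒surjective : X ↔ Fin n → (f : X → X) → Injective _≡_ _≡_ f → StrictlySurjective _≡_ f
↔Fin-injective⇒surjective X↔Fin f f-inj y =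
  let x , fx≡y = Fin-injective⇒surjective (to ∘ f ∘ from) (from-inj ∘ f-inj ∘ to-inj) (to y)
  in from x , to-inj fx≡y
  where
  open Inverse X↔Fin
  to-inj : Injective _≡_ _≡_ to
  to-inj {a} {b} e = trans (sym (strictlyInverseʳ a)) (trans (cong from e) (strictlyInverseʳ b))
  from-inj : Injective _≡_ _≡_ from
  from-inj {a} {b} e = trans (sym (strictlyInverseˡ a)) (trans (cong to e) (strictlyInverseˡ b))

Vec↔Fin : {c : ℕ} → X ↔ Fin c → (k : ℕ) → Vec X k ↔ Fin (c ^ k)
Vec↔Fin X↔Fin zero    = mk↔ₛ′ (λ _ → zero) (λ _ → []) (λ { zero → refl }) (λ { [] → refl })
Vec↔Fin X↔Fin (suc k) = ↔-trans ∷↔× (↔-trans (X↔Fin ×-↔ Vec↔Fin X↔Fin k) (↔-sym Fin.*↔×))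
  where
  ∷↔× : Vec _ (suc k) ↔ (_ × Vec _ k)
  ∷↔× = mk↔ₛ′ (λ xs → Vec.head xs , Vec.tail xs) (λ (x , xs) → x ∷ xs) (λ _ → refl) (λ { (x ∷ xs) → refl })

F2^↔Fin : (k : ℕ) → F2^ k ↔ Fin (2 ^ k)
F2^↔Fin = Vec↔Fin (↔-sym Fin.2↔Bool)

linIndep⇒comb-injective : {M : Mat k n} → LinIndep M → Injective _≡_ _≡_ (λ c → comb c M)
linIndep⇒comb-injective {M = M} indep {c} {d} cM≡dM = ⊕-cancel c d (indep (c ⊕ d) (begin
  comb (c ⊕ d) M         ≡⟨ comb-⊕ c d M ⟩
  comb c M ⊕ comb d M    ≡⟨ cong (_⊕ comb d M) cM≡dM ⟩
  comb d M ⊕ comb d M    ≡⟨ ⊕-self (comb d M) ⟩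
  zeroV                  ∎))
  where open ≡-Reasoning

surjective⇒rightInverse : (M : Mat k n) → StrictlySurjective _≡_ (λ c → comb c M) →
  Σ (Mat n k) λ C → C · M ≡ I
surjective⇒rightInverse M surj = map (proj₁ ∘ surj) I , (begin
  map (λ c → comb c M) (map (proj₁ ∘ surj) I)  ≡⟨ sym (Vec.map-∘ _ _ I) ⟩
  map (λ e → comb (proj₁ (surj e)) M) I        ≡⟨ Vec.map-cong (proj₂ ∘ surj) I ⟩
  map id I                                     ≡⟨ map-id I ⟩
  I                                            ∎)
  where open ≡-Reasoning

comb-rightInverse : (u : F2^ n) {C : Mat n k} {M : Mat k n} → C · M ≡ I → comb (comb u C) M ≡ u
comb-rightInverse u {C} {M} C·M≡I = trans (sym (comb-· u C M)) (trans (cong (comb u) C·M≡I) (comb-I u))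

spannedBy-reindex : {U : Sub n} {B : Mat k n} {G : Mat j n} → SpannedBy U B →
  (g : F2^ j → F2^ k) → StrictlySurjective _≡_ g → (∀ u → comb u G ≡ comb (g u) B) → SpannedBy U G
spannedBy-reindex {B = B} {G} B-span g g-surj comb-G x = mk⇔
  (λ Ux → let c , cB≡x = Equivalence.to (B-span x) Ux
              u , gu≡c = g-surj c
          in u , trans (comb-G u) (trans (cong (λ d → comb d B) gu≡c) cB≡x))
  (λ (u , uG≡x) → Equivalence.from (B-span x) (g u , trans (sym (comb-G u)) uG≡x))

-- L is invertible (injective, hence by counting surjective); with C a right inverse,
-- the rows of [ I ∣ C · R ] are the rows of C · [ L ∣ R ].
spannedBy-[∣]⇒graph : {U : Sub (k + m)} {L : Mat k k} {R : Mat k m} → LinIndep L → SpannedBy U [ L ∣ R ] →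
  Σ (Mat k m) λ A → U ≐ graph A
spannedBy-[∣]⇒graph {k} {U = U} {L} {R} L-indep LR-span =
  C · R , spannedBy-unique (spannedBy-reindex LR-span (λ u → comb u C) C-surj comb-[I∣C·R])
                           (graph-spannedBy (C · R))
  where
  open ≡-Reasoning
  L-inj : Injective _≡_ _≡_ (λ c → comb c L)
  L-inj = linIndep⇒comb-injective L-indep

  C·L≡I : Σ (Mat k k) λ C → C · L ≡ I
  C·L≡I = surjective⇒rightInverse L (↔Fin-injective⇒surjective (F2^↔Fin k) _ L-inj)

  C : Mat k k
  C = proj₁ C·L≡I

  CL : ∀ u → comb (comb u C) L ≡ u
  CL u = comb-rightInverse u (proj₂ C·L≡I)

  C-surj : StrictlySurjective _≡_ (λ u → comb u C)
  C-surj c = comb c L , L-inj (CL (comb c L))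

  comb-[I∣C·R] : ∀ u → comb u [ I ∣ C · R ] ≡ comb (comb u C) [ L ∣ R ]
  comb-[I∣C·R] u = begin
    comb u [ I ∣ C · R ]                     ≡⟨ comb-[I∣] u (C · R) ⟩
    u ++ comb u (C · R)                      ≡⟨ cong₂ _++_ (sym (CL u)) (comb-· u C R) ⟩
    comb (comb u C) L ++ comb (comb u C) R   ≡⟨ sym (comb-[∣] (comb u C) L R) ⟩
    comb (comb u C) [ L ∣ R ]                ∎

transversal⇒graph : {U : Sub (k + m)} → InU (k + m) k U →
  (∀ w → U (zeroV {k} ++ w) ≡ true → w ≡ zeroV) → Σ (Mat k m) λ A → U ≐ graph A
transversal⇒graph {k} {m} {U} (B , B-indep , B-span) transversal =
  spannedBy-[∣]⇒graph L-indep (subst (SpannedBy U) (sym ([take∣drop] B)) B-span)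
  where
  open ≡-Reasoning
  L : Mat k k
  L = map (take k) B
  R : Mat k m
  R = map (drop k) B

  comb-B : ∀ c → comb c B ≡ comb c L ++ comb c R
  comb-B c = trans (cong (comb c) (sym ([take∣drop] B))) (comb-[∣] c L R)

  L-indep : LinIndep L
  L-indep c cL≡0 = B-indep c (begin
    comb c B                ≡⟨ comb-B c ⟩
    comb c L ++ comb c R    ≡⟨ cong₂ _++_ cL≡0 cR≡0 ⟩
    zeroV {k} ++ zeroV {m}  ≡⟨ sym (zeroV-++ {k} {m}) ⟩
    zeroV                   ∎)
    where
    cR≡0 : comb c R ≡ zeroV
    cR≡0 = transversal _ (subst (λ x → U x ≡ true) (trans (comb-B c) (cong (_++ comb c R) cL≡0))
                                (spannedBy-comb B-span c))

mono-sum≡true⇒transversal : {U : Sub (k + m)} → ⊕-Closed U → sumOver U (mono k) ≡ true →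
  ∀ w → U (zeroV {k} ++ w) ≡ true → w ≡ zeroV
mono-sum≡true⇒transversal {k} closed sum≡true w U0w with w ≟ᵥ zeroV
... | yes w≡0 = w≡0
... | no  w≢0 = contradiction (trans (sym sum≡true) (sumOver-mono-vanishes {k} closed U0w w≢0)) λ ()

InN⇒graph : {U : Sub (k + m)} → InN (k + m) k (mono k) U → Σ (Mat k m) λ A → U ≐ graph A
InN⇒graph {k} {U = U} (U∈@(_ , _ , U-span) , sum≡true) =
  transversal⇒graph U∈ (mono-sum≡true⇒transversal {k} {U = U} (spannedBy⇒⊕-closed U-span) sum≡true)

StrictlyIncreasing : (Fin k → Fin n) → Set
StrictlyIncreasing p = ∀ i j → i Fin.< j → p i Fin.< p j

strictlyIncreasing-∘suc : {p : Fin (suc k) → Fin n} → StrictlyIncreasing p → StrictlyIncreasing (p ∘ suc)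
strictlyIncreasing-∘suc p-incr i j = p-incr (suc i) (suc j) ∘ ℕ.s≤s

strictlyIncreasing-gap : (p : Fin k → Fin n) → StrictlyIncreasing p →
  ∀ {i j} → i Fin.≤ j → toℕ j + toℕ (p i) ℕ.≤ toℕ i + toℕ (p j)
strictlyIncreasing-gap p p-incr {zero} {zero} _ = ℕ.≤-refl
strictlyIncreasing-gap {suc (suc k)} p p-incr {zero} {suc j} _ = begin
  suc (toℕ j + toℕ (p zero))  ≡⟨ sym (ℕ.+-suc (toℕ j) _) ⟩
  toℕ j + suc (toℕ (p zero))  ≤⟨ ℕ.+-monoʳ-≤ (toℕ j) (p-incr zero (suc zero) (ℕ.s≤s ℕ.z≤n)) ⟩
  toℕ j + toℕ (p (suc zero))  ≤⟨ strictlyIncreasing-gap (p ∘ suc) (strictlyIncreasing-∘suc p-incr) ℕ.z≤n ⟩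
  toℕ (p (suc j))             ∎
  where open ℕ.≤-Reasoning
strictlyIncreasing-gap p p-incr {suc i} {suc j} (ℕ.s≤s i≤j) =
  ℕ.s≤s (strictlyIncreasing-gap (p ∘ suc) (strictlyIncreasing-∘suc p-incr) i≤j)

-- The last pivot decides: if it lies below k, the gaps force every pivot into place.
pivots-id-or-late : (p : Fin k → Fin n) → StrictlyIncreasing p →
  (∀ i → toℕ (p i) ≡ toℕ i) ⊎ Σ (Fin k) λ i → k ℕ.≤ toℕ (p i)
pivots-id-or-late {zero}  p p-incr = inj₁ λ ()
pivots-id-or-late {suc k} p p-incr with suc k ℕ.≤? toℕ (p (Fin.fromℕ k))
... | yes late = inj₂ (Fin.fromℕ k , late)
... | no ¬late = inj₁ λ i → ℕ.≤-antisym (below i) (above i)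
  where
  gap : ∀ {i j} → i Fin.≤ j → toℕ j + toℕ (p i) ℕ.≤ toℕ i + toℕ (p j)
  gap = strictlyIncreasing-gap p p-incr
  above : ∀ i → toℕ i ℕ.≤ toℕ (p i)
  above i = ℕ.m+n≤o⇒m≤o (toℕ i) (gap {zero} {i} ℕ.z≤n)
  below : ∀ i → toℕ (p i) ℕ.≤ toℕ i
  below i = ℕ.+-cancelˡ-≤ k _ _ (begin
    k + toℕ (p i)                          ≡⟨ cong (_+ toℕ (p i)) (sym (Fin.toℕ-fromℕ k)) ⟩
    toℕ (Fin.fromℕ k) + toℕ (p i)          ≤⟨ gap (Fin.≤fromℕ i) ⟩
    toℕ i + toℕ (p (Fin.fromℕ k))          ≤⟨ ℕ.+-monoʳ-≤ (toℕ i) (ℕ.s≤s⁻¹ (ℕ.≰⇒> ¬late)) ⟩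
    toℕ i + k                              ≡⟨ ℕ.+-comm (toℕ i) k ⟩
    k + toℕ i                              ∎)
    where open ℕ.≤-Reasoning

leading-one-at-or-after : (r : F2^ (k + m)) (q : Fin (k + m)) → k ℕ.≤ toℕ q → lookup r q ≡ true →
  (∀ j → j Fin.< q → lookup r j ≡ false) → Σ (F2^ m) λ w → w ≢ zeroV × r ≡ zeroV ++ w
leading-one-at-or-after {k} {m} r q k≤q rq≡1 r<q≡0 = drop k r , w≢0 , r≡0++w
  where
  take≡0 : take k r ≡ zeroV
  take≡0 = lookup-ext λ j → begin
    lookup (take k r) j                     ≡⟨ Vec.lookup-take-inject≤ r j ⟩
    lookup r (Fin.inject≤ j _)              ≡⟨ r<q≡0 _ (subst (ℕ._< toℕ q) (sym (Fin.toℕ-inject≤ j _))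
                                                              (ℕ.<-≤-trans (Fin.toℕ<n j) k≤q)) ⟩
    false                                   ≡⟨ sym (lookup-replicate j false) ⟩
    lookup zeroV j                          ∎
    where open ≡-Reasoning
  r≡0++w : r ≡ zeroV ++ drop k r
  r≡0++w = trans (sym (take++drop≡id k r)) (cong (_++ drop k r) take≡0)
  w≢0 : drop k r ≢ zeroV
  w≢0 w≡0 = contradiction (begin
    true                               ≡⟨ sym rq≡1 ⟩
    lookup r q                         ≡⟨ cong (λ v → lookup v q) (trans r≡0++w (cong (zeroV ++_) w≡0)) ⟩
    lookup (zeroV {k} ++ zeroV {m}) q  ≡⟨ cong (λ v → lookup v q) (sym (zeroV-++ {k} {m})) ⟩
    lookup zeroV q                     ≡⟨ lookup-replicate q false ⟩
    false                              ∎) λ ()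
    where open ≡-Reasoning

firstColsId⇒sum : {U : Sub (k + m)} {G : Mat k (k + m)} (k≤n : k ℕ.≤ k + m) →
  SpannedBy U G → FirstColsId k≤n G → sumOver U (mono k) ≡ true
firstColsId⇒sum {k} {m} {U} {G} k≤n G-span G[k]≡I = begin
  sumOver U (mono k)          ≡⟨ sumOver-cong (mono k) (spannedBy-unique U-span (graph-spannedBy A)) ⟩
  sumOver (graph A) (mono k)  ≡⟨ sumOver-mono-graph A ⟩
  true                        ∎
  where
  open ≡-Reasoning
  A : Mat k m
  A = map (drop k) G
  take≡I : map (take k) G ≡ I
  take≡I = lookup-ext λ i → trans (lookup-map i (take k) G) (lookup-ext λ j →
    trans (Vec.lookup-take-inject≤ (lookup G i) j) (trans (G[k]≡I i j) (sym (lookup-I i j))))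
  U-span : SpannedBy U [ I ∣ A ]
  U-span = subst (SpannedBy U) (trans (sym ([take∣drop] G)) (cong [_∣ A ] take≡I)) G-span

sum⇒firstColsId : {U : Sub (k + m)} {G : Mat k (k + m)} (k≤n : k ℕ.≤ k + m) →
  IsGU U G → sumOver U (mono k) ≡ true → FirstColsId k≤n G
sum⇒firstColsId {k} {U = U} {G} k≤n ((p , p-incr , p-lead , p-before , p-column) , _ , G-span) sum≡true
  with pivots-id-or-late p p-incr
... | inj₁ p≡id = in-place
  where
  column-j≡pivot-j : ∀ j → Fin.inject≤ j k≤n ≡ p j
  column-j≡pivot-j j = Fin.toℕ-injective (trans (Fin.toℕ-inject≤ j k≤n) (sym (p≡id j)))
  in-place : FirstColsId k≤n G
  in-place i j rewrite column-j≡pivot-j j with i Fin.≟ j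
  ... | yes refl = p-lead i
  ... | no  i≢j  = p-column j i (i≢j ∘ sym)
... | inj₂ (i , late) with leading-one-at-or-after (lookup G i) (p i) late (p-lead i) (p-before i)
...   | w , w≢0 , row-i≡0++w = contradiction (transversal w U0w) w≢0
  where
  transversal : ∀ w → U (zeroV {k} ++ w) ≡ true → w ≡ zeroV
  transversal = mono-sum≡true⇒transversal {k} {U = U} (spannedBy⇒⊕-closed G-span) sum≡true
  U0w : U (zeroV {k} ++ w) ≡ true
  U0w = subst (λ x → U x ≡ true) (trans (comb-lookup-I i G) row-i≡0++w) (spannedBy-comb G-span (lookup I i))

cardIs-tabulate : {P : Sub n → Set} {N : ℕ} (f : Fin N → Sub n) → (∀ {i j} → f i ≐ f j → i ≡ j) →
  (∀ i → P (f i)) → (∀ U → P U → Σ (Fin N) λ i → U ≐ f i) → CardIs P N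
cardIs-tabulate f f-inj f∈P P⊆f =
  List.tabulate f , List.length-tabulate f , All.tabulate⁺ f∈P ,
  AllPairs.tabulate⁺ (λ i≢j fi≐fj → i≢j (f-inj fi≐fj)) ,
  λ U PU → let i , U≐fi = P⊆f U PU in Any.tabulate⁺ i U≐fi

InN-mono-card : (k m : ℕ) → CardIs (InN (k + m) k (mono k)) (2 ^ (k * m))
InN-mono-card k m = subst (CardIs _) (trans (ℕ.^-*-assoc 2 m k) (cong (2 ^_) (ℕ.*-comm m k)))
  (cardIs-tabulate (graph ∘ from) graph∘from-injective (graph-InN ∘ from) InN⊆graph∘from)
  where
  open Inverse (Vec↔Fin (F2^↔Fin m) k)
  graph∘from-injective : ∀ {i j} → graph (from i) ≐ graph (from j) → i ≡ j
  graph∘from-injective {i} {j} e =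
    trans (sym (strictlyInverseˡ i)) (trans (cong to (graph-injective e)) (strictlyInverseˡ j))
  InN⊆graph∘from : ∀ U → InN (k + m) k (mono k) U → Σ (Fin ((2 ^ m) ^ k)) λ i → U ≐ graph (from i)
  InN⊆graph∘from U U∈N = let A , U≐A = InN⇒graph U∈N in
    to A , λ x → trans (U≐A x) (cong (λ B → graph B x) (sym (strictlyInverseʳ A)))

proposition5p1 : (n k : ℕ) → (k≤n : k ≤ n) →
    ((U : Sub n) → InU n k U → (G : Mat k n) → IsGU U G →
      (InN n k (mono k) U ⇔ FirstColsId k≤n G))
    × CardIs (InN n k (mono k)) (2 ^ (k * (n ∸ k)))
proposition5p1 n k k≤n with ℕ.m≤n⇒∃[o]m+o≡n k≤n
... | m , refl rewrite ℕ.m+n∸m≡n k m = characterisation , InN-mono-card k m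
  where
  characterisation : (U : Sub (k + m)) → InU (k + m) k U → (G : Mat k (k + m)) → IsGU U G →
    InN (k + m) k (mono k) U ⇔ FirstColsId k≤n G
  characterisation U U∈ G G-is-GU@(_ , _ , G-span) = mk⇔
    (λ (_ , sum≡true) → sum⇒firstColsId k≤n G-is-GU sum≡true)
    (λ G[k]≡I → U∈ , firstColsId⇒sum k≤n G-span G[k]≡I)
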